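{- For every positive integer $n$, the edgeless graph $\bar{K}_n$ on $n$ vertices is an integral sum graph and $r(\bar{K}_n)=n-1$.
   Context: A graph $G$ is an integral sum graph ($\mathbb{Z}$-graph) if there is an injective map $\lambda:V(G)\to\mathbb{Z}$ (a labelling) such that two distinct vertices $u,v$ are adjacent if and only if $\lambda(u)+\lambda(v)\in\lambda(V(G))$. The radius of a labelling is $\max_{v}|\lambda(v)|$, and the radius $r(G)$ of a $\mathbb{Z}$-graph $G$ is the minimum of the radii of all its labellings. -}

module Defs where

open import Data.Nat using (ℕ; zero; suc; _≤_; _⊔_)
open import Data.Integer using (ℤ; _+_; ∣_∣)
open import Data.Fin using (Fin; zero; suc)
open import Data.Product using (Σ; ∃; _×_)
open import Data.Empty using (⊥)
open import Function using (_∘_; _⇔_)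
open import Function.Definitions using (Injective)
open import Relation.Binary.PropositionalEquality using (_≡_; _≢_)

Graph : ℕ → Set₁
Graph n = Fin n → Fin n → Set

edgeless : (n : ℕ) → Graph n
edgeless n u v = ⊥

IsSumLabelling : {n : ℕ} → Graph n → (Fin n → ℤ) → Set
IsSumLabelling {n} G l =
  Injective _≡_ _≡_ l ×
  (∀ (u v : Fin n) → u ≢ v → (G u v ⇔ (∃ λ (w : Fin n) → l w ≡ l u + l v)))

IsZGraph : {n : ℕ} → Graph n → Set
IsZGraph {n} G = ∃ λ (l : Fin n → ℤ) → IsSumLabelling G l

labelRadius : (n : ℕ) → (Fin n → ℤ) → ℕ
labelRadius zero    l = 0
labelRadius (suc n) l = ∣ l zero ∣ ⊔ labelRadius n (l ∘ suc)

HasRadius : {n : ℕ} → Graph n → ℕ → Set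
HasRadius {n} G r =
  (∃ λ (l : Fin n → ℤ) → IsSumLabelling G l × labelRadius n l ≡ r) ×
  (∀ (l : Fin n → ℤ) → IsSumLabelling G l → r ≤ labelRadius n l)

{-# OPTIONS --safe #-}
-- Let R be the radius of a sum labelling of K̄ₙ; negating all labels if necessary, R is
-- itself a label. The map x ↦ x (x > 0), x ↦ R + x (x ≤ 0) sends [-R, R] into [0, R], and
-- two labels x ≠ y with the same image satisfy x = R + y, a sum of the two distinct labels
-- R and y. Hence the labels inject into [0, R] and n ≤ R + 1.
-- Conversely, the M + 1 labels [⌈M/2⌉, M] ∪ [-M, ⌈M/2⌉ - M - 1] are sum-free: two distinct
-- large ones add up to more than M, two small ones to less than -M, and a mixed sum falls
-- strictly between the two blocks.
module Submission where

open import Defs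
open import Data.Nat using (ℕ; _≤_; _∸_; zero; suc; _+_; _<_; _≤?_; z≤n; s≤s; s≤s⁻¹)
import Data.Nat.Properties as ℕₚ
open import Data.Integer as ℤ using (ℤ; +_; -[1+_]; -_; _-_; _⊖_; ∣_∣)
import Data.Integer.Properties as ℤₚ
open import Data.Integer.Tactic.RingSolver using (solve-∀)
open import Data.Fin using (Fin; toℕ; fromℕ<)
import Data.Fin.Properties as Finₚ
open import Data.Product using (_×_; ∃; _,_; proj₁; proj₂)
open import Data.Sum using (_⊎_; inj₁; inj₂)
open import Data.Empty using (⊥-elim)
open import Function using (_∘_; mk⇔; Equivalence)
open import Function.Definitions using (Injective)
open import Relation.Nullary using (¬_; yes; no)
open import Relation.Binary.PropositionalEquality
open import Relation.Binary.Definitions using (tri<; tri≈; tri>)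

∣l∣≤labelRadius : ∀ {n} (l : Fin n → ℤ) v → ∣ l v ∣ ≤ labelRadius n l
∣l∣≤labelRadius l Fin.zero    = ℕₚ.m≤m⊔n _ _
∣l∣≤labelRadius l (Fin.suc v) = ℕₚ.≤-trans (∣l∣≤labelRadius (l ∘ Fin.suc) v) (ℕₚ.m≤n⊔m _ _)

labelRadius-lub : ∀ {n} (l : Fin n → ℤ) {r} → (∀ v → ∣ l v ∣ ≤ r) → labelRadius n l ≤ r
labelRadius-lub {zero}  l _       = z≤n
labelRadius-lub {suc n} l bounded =
  ℕₚ.⊔-lub (bounded Fin.zero) (labelRadius-lub (l ∘ Fin.suc) (bounded ∘ Fin.suc))

labelRadius-attained : ∀ {n} (l : Fin (suc n) → ℤ) → ∃ λ m → ∣ l m ∣ ≡ labelRadius (suc n) l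
labelRadius-attained {zero} l = Fin.zero , sym (ℕₚ.⊔-identityʳ _)
labelRadius-attained {suc n} l with ℕₚ.⊔-sel ∣ l Fin.zero ∣ (labelRadius (suc n) (l ∘ Fin.suc))
... | inj₁ eq = Fin.zero , sym eq
... | inj₂ eq with labelRadius-attained (l ∘ Fin.suc)
...   | m , ∣lm∣≡r = Fin.suc m , trans ∣lm∣≡r (sym eq)

SumFree : ∀ {n} → (Fin n → ℤ) → Set
SumFree {n} l = ∀ (u v w : Fin n) → u ≢ v → l w ≢ l u ℤ.+ l v

isSumLabelling⇒sumFree : ∀ {n} {l : Fin n → ℤ} → IsSumLabelling (edgeless n) l → SumFree l
isSumLabelling⇒sumFree (_ , adjacent⇔) u v w u≢v eq = Equivalence.from (adjacent⇔ u v u≢v) (w , eq)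

sumFree⇒isSumLabelling : ∀ {n} {l : Fin n → ℤ} →
  Injective _≡_ _≡_ l → SumFree l → IsSumLabelling (edgeless n) l
sumFree⇒isSumLabelling injective sumFree =
  injective , λ u v u≢v → mk⇔ (λ ()) (λ (w , eq) → sumFree u v w u≢v eq)

sumFree-neg : ∀ {n} {l : Fin n → ℤ} → SumFree l → SumFree (-_ ∘ l)
sumFree-neg {l = l} sumFree u v w u≢v eq =
  sumFree u v w u≢v (ℤₚ.neg-injective (trans eq (sym (ℤₚ.neg-distrib-+ (l u) (l v)))))

data PosOrNonPos : ℤ → Set where
  positive    : ∀ k → PosOrNonPos (+ suc k)
  nonPositive : ∀ k → PosOrNonPos (- + k)

posOrNonPos : ∀ x → PosOrNonPos x
posOrNonPos (+ zero)  = nonPositive 0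
posOrNonPos (+ suc k) = positive k
posOrNonPos -[1+ k ]  = nonPositive (suc k)

fold : ℕ → ℤ → ℕ
fold R (+ zero)  = R
fold R (+ suc k) = suc k
fold R -[1+ k ]  = R ∸ suc k

fold-nonPositive : ∀ R k → fold R (- + k) ≡ R ∸ k
fold-nonPositive R zero    = refl
fold-nonPositive R (suc k) = refl

fold≤ : ∀ {R} x → ∣ x ∣ ≤ R → fold R x ≤ R
fold≤ x ∣x∣≤R with posOrNonPos x
... | positive k    = ∣x∣≤R
... | nonPositive k = subst (_≤ _) (sym (fold-nonPositive _ k)) (ℕₚ.m∸n≤m _ k)

∣-+k∣≤R⇒k≤R : ∀ {k R} → ∣ - + k ∣ ≤ R → k ≤ R
∣-+k∣≤R⇒k≤R {k} = subst (_≤ _) (ℤₚ.∣-i∣≡∣i∣ (+ k))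

-+k≢+R : ∀ {k R} → 0 < R → - + k ≢ + R
-+k≢+R {zero}  (s≤s _) ()
-+k≢+R {suc k} (s≤s _) ()

Wraps : ℕ → ℤ → ℤ → Set
Wraps R x y = x ≡ + R ℤ.+ y × y ≢ + R

fold-collision : ∀ {R} j k → suc j ≤ R → ∣ - + k ∣ ≤ R → suc j ≡ fold R (- + k) →
                 Wraps R (+ suc j) (- + k)
fold-collision {R} j k j<R ∣-k∣≤R eq =
  (begin
    + suc j        ≡⟨ cong +_ (trans eq (fold-nonPositive R k)) ⟩
    + (R ∸ k)      ≡⟨ ℤₚ.⊖-≥ (∣-+k∣≤R⇒k≤R {k} ∣-k∣≤R) ⟨
    R ⊖ k          ≡⟨ ℤₚ.m-n≡m⊖n R k ⟨
    + R ℤ.+ - + k  ∎)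
  , -+k≢+R (ℕₚ.<-≤-trans (s≤s z≤n) j<R)
  where open ≡-Reasoning

fold-injective : ∀ {R} x y → ∣ x ∣ ≤ R → ∣ y ∣ ≤ R → fold R x ≡ fold R y →
                 x ≡ y ⊎ Wraps R x y ⊎ Wraps R y x
fold-injective {R} x y ∣x∣≤R ∣y∣≤R eq with posOrNonPos x | posOrNonPos y
... | positive j    | positive k    = inj₁ (cong +_ eq)
... | positive j    | nonPositive k = inj₂ (inj₁ (fold-collision j k ∣x∣≤R ∣y∣≤R eq))
... | nonPositive j | positive k    = inj₂ (inj₂ (fold-collision k j ∣y∣≤R ∣x∣≤R (sym eq)))
... | nonPositive j | nonPositive k =
  inj₁ (cong (-_ ∘ +_) (ℕₚ.∸-cancelˡ-≡ (∣-+k∣≤R⇒k≤R {j} ∣x∣≤R) (∣-+k∣≤R⇒k≤R {k} ∣y∣≤R) (begin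
    R ∸ j          ≡⟨ fold-nonPositive R j ⟨
    fold R (- + j) ≡⟨ eq ⟩
    fold R (- + k) ≡⟨ fold-nonPositive R k ⟩
    R ∸ k          ∎)))
  where open ≡-Reasoning

module _ {n} {l : Fin n → ℤ} (injective : Injective _≡_ _≡_ l) (sumFree : SumFree l) where

  sumFree-size≤ : ∀ {R} m → l m ≡ + R → (∀ v → ∣ l v ∣ ≤ R) → n ≤ suc R
  sumFree-size≤ {R} m lm≡R bounded = Finₚ.injective⇒≤ folded-injective
    where
    folded : Fin n → Fin (suc R)
    folded v = fromℕ< (s≤s (fold≤ (l v) (bounded v)))

    no-wrap : ∀ u v → ¬ Wraps R (l u) (l v)
    no-wrap u v (lu≡R+lv , lv≢R) = sumFree m v u
      (λ m≡v → lv≢R (trans (cong l (sym m≡v)) lm≡R))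
      (trans lu≡R+lv (cong (ℤ._+ l v) (sym lm≡R)))

    folded-injective : Injective _≡_ _≡_ folded
    folded-injective {u} {v} eq
      with fold-injective (l u) (l v) (bounded u) (bounded v)
             (trans (sym (Finₚ.toℕ-fromℕ< _)) (trans (cong toℕ eq) (Finₚ.toℕ-fromℕ< _)))
    ... | inj₁ lu≡lv        = injective lu≡lv
    ... | inj₂ (inj₁ wraps) = ⊥-elim (no-wrap u v wraps)
    ... | inj₂ (inj₂ wraps) = ⊥-elim (no-wrap v u wraps)

sumFree⇒n≤labelRadius : ∀ {n} {l : Fin (suc n) → ℤ} →
  Injective _≡_ _≡_ l → SumFree l → n ≤ labelRadius (suc n) l
sumFree⇒n≤labelRadius {l = l} injective sumFree with labelRadius-attained l
... | m , ∣lm∣≡R with ℤₚ.+∣i∣≡i⊎+∣i∣≡-i (l m)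
...   | inj₁ +∣lm∣≡lm = s≤s⁻¹ (sumFree-size≤ injective sumFree m
          (trans (sym +∣lm∣≡lm) (cong +_ ∣lm∣≡R))
          (∣l∣≤labelRadius l))
...   | inj₂ +∣lm∣≡-lm = s≤s⁻¹ (sumFree-size≤ (injective ∘ ℤₚ.neg-injective) (sumFree-neg sumFree) m
          (trans (sym +∣lm∣≡-lm) (cong +_ ∣lm∣≡R))
          (λ v → subst (_≤ _) (sym (ℤₚ.∣-i∣≡∣i∣ (l v))) (∣l∣≤labelRadius l v)))

isSumLabelling⇒n≤labelRadius : ∀ {n} {l : Fin (suc n) → ℤ} →
  IsSumLabelling (edgeless (suc n)) l → n ≤ labelRadius (suc n) l
isSumLabelling⇒n≤labelRadius isSumLabelling =
  sumFree⇒n≤labelRadius (proj₁ isSumLabelling) (isSumLabelling⇒sumFree isSumLabelling)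

differences-sum : ∀ {a b c d e f : ℤ} →
  (a - b) ℤ.+ (c - d) ≡ e - f → f ℤ.+ (a ℤ.+ c) ≡ b ℤ.+ d ℤ.+ e
differences-sum {a} {b} {c} {d} {e} {f} eq = begin
  f ℤ.+ (a ℤ.+ c)                              ≡⟨ regroup a b c d f ⟩
  f ℤ.+ ((a - b) ℤ.+ (c - d)) ℤ.+ (b ℤ.+ d)  ≡⟨ cong (λ x → f ℤ.+ x ℤ.+ (b ℤ.+ d)) eq ⟩
  f ℤ.+ (e - f) ℤ.+ (b ℤ.+ d)                 ≡⟨ cancel e f b d ⟩
  b ℤ.+ d ℤ.+ e                                ∎
  where
  open ≡-Reasoning
  regroup : ∀ a b c d f → f ℤ.+ (a ℤ.+ c) ≡ f ℤ.+ ((a - b) ℤ.+ (c - d)) ℤ.+ (b ℤ.+ d)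
  regroup = solve-∀
  cancel : ∀ e f b d → f ℤ.+ (e - f) ℤ.+ (b ℤ.+ d) ≡ b ℤ.+ d ℤ.+ e
  cancel = solve-∀

⊖-sum⇒ : ∀ {a b c d e f} → (a ⊖ b) ℤ.+ (c ⊖ d) ≡ e ⊖ f → f + (a + c) ≡ b + d + e
⊖-sum⇒ {a} {b} {c} {d} {e} {f} eq =
  ℤₚ.+-injective (differences-sum {+ a} {+ b} {+ c} {+ d} {+ e} {+ f} (begin
    (+ a - + b) ℤ.+ (+ c - + d)  ≡⟨ cong₂ ℤ._+_ (ℤₚ.m-n≡m⊖n a b) (ℤₚ.m-n≡m⊖n c d) ⟩
    (a ⊖ b) ℤ.+ (c ⊖ d)          ≡⟨ eq ⟩
    e ⊖ f                        ≡⟨ ℤₚ.m-n≡m⊖n e f ⟨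
    + e - + f                    ∎))
  where open ≡-Reasoning

data Shift (M c : ℕ) : ℕ → Set where
  keep : M ≤ c + c → Shift M c 0
  down : c + c < M → Shift M c M

shift : ∀ M c → ∃ (Shift M c)
shift M c with M ≤? c + c
... | yes M≤2c = 0 , keep M≤2c
... | no  M≰2c = M , down (ℕₚ.≰⇒> M≰2c)

shift≤ : ∀ {M c s} → Shift M c s → s ≤ M
shift≤ (keep _) = z≤n
shift≤ (down _) = ℕₚ.≤-refl

fold-shifted : ∀ {M c s} → Shift M c s → c ≤ M → fold M (c ⊖ s) ≡ c
fold-shifted {c = zero}  (keep M≤0) _ = ℕₚ.n≤0⇒n≡0 M≤0
fold-shifted {c = suc c} (keep _)   _ = refl
fold-shifted {M} {c} (down _) c≤M = begin
  fold M (c ⊖ M)        ≡⟨ cong (fold M) (ℤₚ.⊖-≤ c≤M) ⟩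
  fold M (- + (M ∸ c))  ≡⟨ fold-nonPositive M (M ∸ c) ⟩
  M ∸ (M ∸ c)           ≡⟨ ℕₚ.m∸[m∸n]≡n c≤M ⟩
  c                     ∎
  where open ≡-Reasoning

∣shifted∣≤ : ∀ {M c s} → Shift M c s → c ≤ M → ∣ c ⊖ s ∣ ≤ M
∣shifted∣≤ (keep _) c≤M = c≤M
∣shifted∣≤ {M} {c} (down _) c≤M = subst (_≤ M) (sym (ℤₚ.∣⊖∣-≤ c≤M)) (ℕₚ.m∸n≤m M c)

upper-sum : ∀ {M a b} → M ≤ a + a → M ≤ b + b → a ≢ b → M < a + b
upper-sum {a = a} {b} M≤2a M≤2b a≢b with ℕₚ.<-cmp a b
... | tri< a<b _ _ = ℕₚ.≤-<-trans M≤2a (ℕₚ.+-monoʳ-< a a<b)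
... | tri≈ _ a≡b _ = ⊥-elim (a≢b a≡b)
... | tri> _ _ b<a = ℕₚ.≤-<-trans M≤2b (ℕₚ.+-monoˡ-< b b<a)

lower-sum : ∀ {M a b} → a + a < M → b + b < M → a + b < M
lower-sum {a = a} {b} 2a<M 2b<M with ℕₚ.≤-total a b
... | inj₁ a≤b = ℕₚ.≤-<-trans (ℕₚ.+-monoˡ-≤ b a≤b) 2b<M
... | inj₂ b≤a = ℕₚ.≤-<-trans (ℕₚ.+-monoʳ-≤ a b≤a) 2a<M

no-mixed-shifted-sum : ∀ {M a b c r} → M ≤ a + a → b + b < M → Shift M c r →
                       a ≤ M → r + (a + b) ≢ M + c
no-mixed-shifted-sum {M} {a} {b} {c} _ 2b<M (keep M≤2c) a≤M eq =
  ℕₚ.<⇒≱ (ℕₚ.≤-<-trans (ℕₚ.+-mono-≤ c≤b c≤b) 2b<M) M≤2c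
  where
  c≤b : c ≤ b
  c≤b = ℕₚ.+-cancelˡ-≤ M c b (ℕₚ.≤-trans (ℕₚ.≤-reflexive (sym eq)) (ℕₚ.+-monoˡ-≤ b a≤M))
no-mixed-shifted-sum {M} {a} {b} {c} M≤2a _ (down 2c<M) _ eq =
  ℕₚ.<⇒≱ 2c<M (ℕₚ.≤-trans M≤2a (ℕₚ.+-mono-≤ a≤c a≤c))
  where
  a≤c : a ≤ c
  a≤c = ℕₚ.≤-trans (ℕₚ.m≤m+n a b) (ℕₚ.≤-reflexive (ℕₚ.+-cancelˡ-≡ M (a + b) c eq))

no-shifted-sum : ∀ {M a b c s t r} → Shift M a s → Shift M b t → Shift M c r →
                 a ≢ b → a ≤ M → b ≤ M → c ≤ M → r + (a + b) ≢ s + t + c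
no-shifted-sum {a = a} {b} {r = r} (keep M≤2a) (keep M≤2b) _ a≢b _ _ c≤M eq =
  ℕₚ.<⇒≱ (upper-sum {a = a} {b} M≤2a M≤2b a≢b)
    (ℕₚ.≤-trans (ℕₚ.≤-trans (ℕₚ.m≤n+m (a + b) r) (ℕₚ.≤-reflexive eq)) c≤M)
no-shifted-sum {M} {a} {b} {c} (down 2a<M) (down 2b<M) shift-c _ _ _ _ eq =
  ℕₚ.<⇒≱ (ℕₚ.+-mono-≤-< (shift≤ shift-c) (lower-sum {a = a} {b} 2a<M 2b<M))
    (ℕₚ.≤-trans (ℕₚ.m≤m+n (M + M) c) (ℕₚ.≤-reflexive (sym eq)))
no-shifted-sum (keep M≤2a) (down 2b<M) shift-c _ a≤M _ _ eq =
  no-mixed-shifted-sum M≤2a 2b<M shift-c a≤M eq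
no-shifted-sum {M} {a} {b} {c} {r = r} (down 2a<M) (keep M≤2b) shift-c _ _ b≤M _ eq =
  no-mixed-shifted-sum M≤2b 2a<M shift-c b≤M
    (trans (cong (_+_ r) (ℕₚ.+-comm b a)) (trans eq (cong (_+ c) (ℕₚ.+-identityʳ M))))

shifted-sumFree : ∀ {M a b c s t r} → Shift M a s → Shift M b t → Shift M c r →
                  a ≢ b → a ≤ M → b ≤ M → c ≤ M → c ⊖ r ≢ (a ⊖ s) ℤ.+ (b ⊖ t)
shifted-sumFree {a = a} {b} {c} {s} {t} {r} sa sb sc a≢b a≤M b≤M c≤M eq =
  no-shifted-sum sa sb sc a≢b a≤M b≤M c≤M (⊖-sum⇒ {a} {s} {b} {t} {c} {r} (sym eq))

halfShifted : (M : ℕ) → Fin (suc M) → ℤ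
halfShifted M i = toℕ i ⊖ proj₁ (shift M (toℕ i))

module _ (M : ℕ) where

  shift-halfShifted : (i : Fin (suc M)) → Shift M (toℕ i) (proj₁ (shift M (toℕ i)))
  shift-halfShifted i = proj₂ (shift M (toℕ i))

  halfShifted-injective : Injective _≡_ _≡_ (halfShifted M)
  halfShifted-injective {u} {v} eq = Finₚ.toℕ-injective (begin
    toℕ u                     ≡⟨ fold-shifted (shift-halfShifted u) (Finₚ.toℕ≤pred[n] u) ⟨
    fold M (halfShifted M u)  ≡⟨ cong (fold M) eq ⟩
    fold M (halfShifted M v)  ≡⟨ fold-shifted (shift-halfShifted v) (Finₚ.toℕ≤pred[n] v) ⟩
    toℕ v                     ∎)
    where open ≡-Reasoning

  halfShifted-sumFree : SumFree (halfShifted M)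
  halfShifted-sumFree u v w u≢v eq =
    shifted-sumFree (shift-halfShifted u) (shift-halfShifted v) (shift-halfShifted w)
      (u≢v ∘ Finₚ.toℕ-injective)
      (Finₚ.toℕ≤pred[n] u) (Finₚ.toℕ≤pred[n] v) (Finₚ.toℕ≤pred[n] w) eq

  labelRadius-halfShifted≤ : labelRadius (suc M) (halfShifted M) ≤ M
  labelRadius-halfShifted≤ =
    labelRadius-lub (halfShifted M) (λ i → ∣shifted∣≤ (shift-halfShifted i) (Finₚ.toℕ≤pred[n] i))

mainTheorem7 : (n : ℕ) → 1 ≤ n →
    IsZGraph (edgeless n) × HasRadius (edgeless n) (n ∸ 1)
mainTheorem7 (suc M) _ =
  (halfShifted M , isSumLabelling) ,
  (halfShifted M , isSumLabelling , radius≡M) ,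
  λ _ → isSumLabelling⇒n≤labelRadius
  where
  isSumLabelling : IsSumLabelling (edgeless (suc M)) (halfShifted M)
  isSumLabelling = sumFree⇒isSumLabelling (halfShifted-injective M) (halfShifted-sumFree M)

  radius≡M : labelRadius (suc M) (halfShifted M) ≡ M
  radius≡M = ℕₚ.≤-antisym (labelRadius-halfShifted≤ M)
    (isSumLabelling⇒n≤labelRadius isSumLabelling)
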